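{- Every diamond-free graph with at least one edge has an effective competition cover.
   Context: All graphs are finite and simple; digraphs are finite, without loops or multiple arcs. A diamond is $K_4$ minus one edge; a graph is diamond-free if it contains no induced diamond. A clique is a vertex set inducing a complete subgraph; it covers an edge if it contains both ends. The competition graph $C(D)$ of a digraph $D$ has vertex set $V(D)$, and distinct $x,y$ are adjacent iff some $z$ has arcs $(x,z),(y,z)$ in $D$. The competition number $k(G)$ is the smallest $k\ge0$ such that $G$ together with $k$ new isolated vertices is the competition graph of an acyclic digraph. An edge clique cover is a family of cliques covering all edges; $\theta_e(G)$ is the minimum size of one; a minimum edge clique cover has size $\theta_e(G)$. For $G$ with at least one edge, a minimum edge clique cover $\mathcal{C}=\{C_1,\dots,C_{\theta_e(G)}\}$ is an effective competition cover if every $C_i$ is a maximal clique and there is an acyclic digraph $D$ whose competition graph is $G$ together with $k(G)$ isolated vertices, such that the set of vertices of nonzero in-degree of $D$ is $\{w_1,\dots,w_{\theta_e(G)}\}$ where each $w_i$ is a common out-neighbor of all vertices of $C_i$. -}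

module Defs where

open import Data.Nat using (ℕ; _+_; _≤_)
open import Data.Fin using (Fin; _↑ˡ_; splitAt)
open import Data.Fin.Subset using (Subset; _∈_; _⊆_)
open import Data.Bool using (Bool; true; false; T)
open import Data.Sum using (_⊎_; inj₁; inj₂)
open import Data.Product using (Σ; ∃; _×_; _,_)
open import Relation.Binary.PropositionalEquality using (_≡_; _≢_)
open import Relation.Binary.Construct.Closure.Transitive using (TransClosure)
open import Relation.Nullary using (¬_)

record Graph (n : ℕ) : Set where
  field
    adj    : Fin n → Fin n → Bool
    sym    : ∀ x y → adj x y ≡ adj y x
    irrefl : ∀ x → adj x x ≡ false
open Graph public

record Digraph (m : ℕ) : Set where
  field
    arc      : Fin m → Fin m → Bool
    loopless : ∀ x → arc x x ≡ false
open Digraph public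

Arc : ∀ {m} → Digraph m → Fin m → Fin m → Set
Arc D x y = T (arc D x y)

Acyclic : ∀ {m} → Digraph m → Set
Acyclic D = ∀ x → ¬ TransClosure (Arc D) x x

Adj : ∀ {n} → Graph n → Fin n → Fin n → Set
Adj G x y = T (adj G x y)

HasEdge : ∀ {n} → Graph n → Set
HasEdge G = ∃ λ x → ∃ λ y → Adj G x y

-- induced diamond: a,b adjacent, both adjacent to c and d, c,d distinct and non-adjacent
-- (distinctness of the other pairs follows from irreflexivity of adjacency)
DiamondFree : ∀ {n} → Graph n → Set
DiamondFree G = ∀ a b c d → Adj G a b → Adj G a c → Adj G a d → Adj G b c → Adj G b d →
                c ≢ d → Adj G c d

-- G together with k new isolated vertices: old vertices are i ↑ˡ k, new ones n ↑ʳ j.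
addIsolated : ∀ {n} → Graph n → (k : ℕ) → Fin (n + k) → Fin (n + k) → Bool
addIsolated {n} G k x y with splitAt n x | splitAt n y
... | inj₁ i | inj₁ j = adj G i j
... | _      | _      = false

IsCompetitionGraphOf : ∀ {n} → (G : Graph n) → (k : ℕ) → Digraph (n + k) → Set
IsCompetitionGraphOf G k D = ∀ x y → x ≢ y →
  (T (addIsolated G k x y) → ∃ λ z → Arc D x z × Arc D y z) ×
  ((∃ λ z → Arc D x z × Arc D y z) → T (addIsolated G k x y))

Realizable : ∀ {n} → Graph n → ℕ → Set
Realizable {n} G k = Σ (Digraph (n + k)) λ D → Acyclic D × IsCompetitionGraphOf G k D

IsCompetitionNumber : ∀ {n} → Graph n → ℕ → Set
IsCompetitionNumber G k = Realizable G k × (∀ k' → Realizable G k' → k ≤ k')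

IsClique : ∀ {n} → Graph n → Subset n → Set
IsClique G C = ∀ x y → x ∈ C → y ∈ C → x ≢ y → Adj G x y

IsMaximalClique : ∀ {n} → Graph n → Subset n → Set
IsMaximalClique G C = IsClique G C × (∀ C' → IsClique G C' → C ⊆ C' → C' ⊆ C)

IsEdgeCliqueCover : ∀ {n} → Graph n → (t : ℕ) → (Fin t → Subset n) → Set
IsEdgeCliqueCover G t C = (∀ i → IsClique G (C i)) ×
  (∀ x y → Adj G x y → ∃ λ i → x ∈ C i × y ∈ C i)

IsMinimumEdgeCliqueCover : ∀ {n} → Graph n → (t : ℕ) → (Fin t → Subset n) → Set
IsMinimumEdgeCliqueCover {n} G t C = IsEdgeCliqueCover G t C ×
  (∀ t' (C' : Fin t' → Subset n) → IsEdgeCliqueCover G t' C' → t ≤ t')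

IsEffectiveCompetitionCover : ∀ {n} → Graph n → (t : ℕ) → (Fin t → Subset n) → Set
IsEffectiveCompetitionCover {n} G t C =
  IsMinimumEdgeCliqueCover G t C ×
  (∀ i → IsMaximalClique G (C i)) ×
  Σ ℕ λ k → IsCompetitionNumber G k ×
  Σ (Digraph (n + k)) λ D → Acyclic D × IsCompetitionGraphOf G k D ×
  Σ (Fin t → Fin (n + k)) λ w →
    (∀ v → (∃ λ u → Arc D u v) → ∃ λ i → w i ≡ v) ×
    (∀ v → (∃ λ i → w i ≡ v) → ∃ λ u → Arc D u v) ×
    (∀ i x → x ∈ C i → Arc D (x ↑ˡ k) (w i))

-- In a diamond-free graph the closed common neighbourhood M x y of an edge
-- xy is a clique, and it is the only maximal clique containing xy; hence
-- the distinct sets M x y form an edge clique cover C_1..C_t by maximal,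
-- pairwise edge-disjoint cliques, and every edge clique cover needs at
-- least t cliques.
--
-- The competition number is computed through a finite characterisation.
-- A "ranked labelling" with k extra vertices consists of distinct vertices
-- w_1..w_t of G + k isolated vertices and a ranking in which every member of
-- C_i precedes w_i.  A ranked labelling yields an acyclic digraph, with arcs
-- x -> w_i for x in C_i, whose competition graph is G plus k isolated
-- vertices and whose vertices of positive in-degree are exactly the w_i.
-- Conversely a topological ranking of any acyclic realization, together
-- with a latest common out-neighbour of an edge generating each C_i, is a
-- ranked labelling.  Ranked labellings are decidable by finite search, so the
-- least k admitting one is the competition number, and the digraph built
-- from that labelling witnesses that C is an effective competition cover.
module Submission where

open import Defs hiding (sym)
open import Data.Nat as ℕ using (ℕ; zero; suc; _+_; z≤n; s≤s)
import Data.Nat.Properties as ℕₚ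
open import Data.Fin as Fin using (Fin; toℕ; _↑ˡ_; _↑ʳ_; splitAt; punchIn; punchOut; fromℕ; inject₁)
open import Data.Fin.Properties as Finₚ using (_≟_; any?; all?; pigeonhole)
open import Data.Fin.Subset using (Subset; _∈_; _⊆_)
open import Data.Fin.Subset.Properties using (_∈?_; ⊆-antisym)
open import Data.Bool as Bool using (T; T?)
open import Data.Bool.Properties using (T-≡; T-not-≡)
open import Data.Vec using (tabulate)
open import Data.Vec.Properties using ([]=⇒lookup; lookup⇒[]=; lookup∘tabulate; ≡-dec)
open import Data.List as List using (List; _∷_; filter; map; cartesianProduct; allFin; deduplicate; length)
open import Data.List.Membership.Propositional using () renaming (_∈_ to _∈ˡ_)
open import Data.List.Membership.Propositional.Properties
  using (∈-map∘filter⁻; ∈-map∘filter⁺; ∈-deduplicate⁻; ∈-deduplicate⁺; ∈-lookup; ∈-allFin; ∈-cartesianProduct⁺; ∈-filter⁺)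
open import Data.List.Relation.Unary.Any as Any using ()
open import Data.List.Relation.Unary.Any.Properties using (lookup-index)
open import Data.List.Relation.Unary.All as All using ()
open import Data.List.Relation.Unary.All.Properties using (all-filter)
open import Data.List.Relation.Unary.AllPairs using (_∷_)
open import Data.List.Relation.Unary.Unique.Propositional using (Unique)
open import Data.List.Relation.Unary.Unique.DecPropositional.Properties using (deduplicate-!)
open import Data.List.Extrema.Nat using (argmax; argmax-all; f[xs]≤f[argmax])
open import Data.Sum using (_⊎_; inj₁; inj₂)
open import Data.Product using (Σ; ∃; ∃₂; _×_; _,_; proj₁; proj₂; uncurry)
open import Data.Empty using (⊥-elim)
open import Function using (_∘_; Equivalence)
open import Relation.Nullary using (¬_; Dec; yes; no; contradiction; ¬?)
open import Relation.Nullary.Decidable using (⌊_⌋; toWitness; fromWitness; fromWitnessFalse; _×-dec_; _⊎-dec_; _→-dec_)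
open import Relation.Unary using (Decidable)
open import Relation.Binary.PropositionalEquality
open import Relation.Binary.Construct.Closure.Transitive using (TransClosure; [_]; _∷_; _∷ʳ_)

lookup-injective : ∀ {A : Set} (xs : List A) → Unique xs →
                   ∀ i j → List.lookup xs i ≡ List.lookup xs j → i ≡ j
lookup-injective (x ∷ xs) u         Fin.zero    Fin.zero    e = refl
lookup-injective (x ∷ xs) (x∉ ∷ u)  Fin.zero    (Fin.suc j) e = ⊥-elim (All.lookup x∉ (∈-lookup j) e)
lookup-injective (x ∷ xs) (x∉ ∷ u)  (Fin.suc i) Fin.zero    e = ⊥-elim (All.lookup x∉ (∈-lookup i) (sym e))
lookup-injective (x ∷ xs) (_ ∷ u)   (Fin.suc i) (Fin.suc j) e = cong Fin.suc (lookup-injective xs u i j e)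

subsetOf : ∀ {n} {P : Fin n → Set} → Decidable P → Subset n
subsetOf P? = tabulate (λ z → ⌊ P? z ⌋)

∈-subsetOf⁻ : ∀ {n} {P : Fin n → Set} (P? : Decidable P) {z} → z ∈ subsetOf P? → P z
∈-subsetOf⁻ P? {z} z∈ =
  toWitness {a? = P? z} (Equivalence.from T-≡ (trans (sym (lookup∘tabulate _ z)) ([]=⇒lookup z∈)))

∈-subsetOf⁺ : ∀ {n} {P : Fin n → Set} (P? : Decidable P) {z} → P z → z ∈ subsetOf P?
∈-subsetOf⁺ P? {z} p =
  lookup⇒[]= z _ (trans (lookup∘tabulate _ z) (Equivalence.to T-≡ (fromWitness {a? = P? z} p)))

_∷ᶠ_ : ∀ {a b} → Fin b → (Fin a → Fin b) → Fin (suc a) → Fin b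
(y ∷ᶠ g) Fin.zero    = y
(y ∷ᶠ g) (Fin.suc i) = g i

∃-function? : ∀ a b {P : (Fin a → Fin b) → Set} →
              (∀ {f g} → (∀ x → f x ≡ g x) → P f → P g) →
              (∀ f → Dec (P f)) → Dec (∃ P)
∃-function? zero b {P} resp P? with P? (λ ())
... | yes p = yes (_ , p)
... | no ¬p = no λ { (f , p) → ¬p (resp (λ ()) p) }
∃-function? (suc a) b {P} resp P?
  with any? (λ y → ∃-function? a b (λ f≗g → resp (extend y f≗g)) (λ g → P? (y ∷ᶠ g)))
  where
  extend : ∀ y {f g : Fin a → Fin b} → (∀ x → f x ≡ g x) → ∀ x → (y ∷ᶠ f) x ≡ (y ∷ᶠ g) x
  extend y f≗g Fin.zero    = refl
  extend y f≗g (Fin.suc x) = f≗g x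
... | yes (y , g , p) = yes (_ , p)
... | no none = no λ { (f , p) → none (f Fin.zero , f ∘ Fin.suc , resp split p) }
  where
  split : ∀ {f : Fin (suc a) → Fin b} x → f x ≡ (f Fin.zero ∷ᶠ (f ∘ Fin.suc)) x
  split Fin.zero    = refl
  split (Fin.suc x) = refl

least : ∀ {P : ℕ → Set} → (∀ k → Dec (P k)) → ∀ m → P m →
        ∃ λ k → P k × (∀ j → P j → k ℕ.≤ j)
least P? zero p = zero , p , λ _ _ → z≤n
least P? (suc m) p with P? zero
... | yes p₀ = zero , p₀ , λ _ _ → z≤n
... | no ¬p₀ with least (P? ∘ suc) m p
...   | k , pk , k-min = suc k , pk , λ { zero p₀ → contradiction p₀ ¬p₀ ; (suc j) pj → s≤s (k-min j pj) }

maximise : ∀ {N} {P : Fin N → Set} → Decidable P → (f : Fin N → ℕ) → ∃ P →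
           ∃ λ z → P z × (∀ y → P y → f y ℕ.≤ f z)
maximise {N} P? f (z₀ , p₀) =
  argmax f z₀ ys , argmax-all f p₀ (all-filter P? (allFin N)) ,
  λ y py → All.lookup (f[xs]≤f[argmax] {f = f} z₀ ys) (∈-filter⁺ P? (∈-allFin y) py)
  where
  ys : List (Fin N)
  ys = filter P? (allFin N)

NoCycle : ∀ {N} → (Fin N → Fin N → Set) → Set
NoCycle A = ∀ x → ¬ TransClosure A x x

map⁺ : ∀ {X Y : Set} {R : X → X → Set} {S : Y → Y → Set} (f : X → Y) →
       (∀ {a b} → R a b → S (f a) (f b)) → ∀ {a b} → TransClosure R a b → TransClosure S (f a) (f b)
map⁺ f R⇒S [ r ]    = [ R⇒S r ]
map⁺ f R⇒S (r ∷ rs) = R⇒S r ∷ map⁺ f R⇒S rs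

-- If every vertex has an out-neighbour, the orbit of iterated out-neighbours
-- revisits a vertex (pigeonhole), and the walk between the visits is a cycle.
module _ {N} {A : Fin (suc N) → Fin (suc N) → Set}
         (next : Fin (suc N) → Fin (suc N)) (step : ∀ v → A v (next v)) where

  orbit : ℕ → Fin (suc N)
  orbit zero    = Fin.zero
  orbit (suc i) = next (orbit i)

  orbit-walk : ∀ d i → TransClosure A (orbit i) (orbit (suc (d + i)))
  orbit-walk zero    i = [ step (orbit i) ]
  orbit-walk (suc d) i = orbit-walk d i ∷ʳ step (orbit (suc (d + i)))

  successor-cycle : ∃ λ x → TransClosure A x x
  successor-cycle with pigeonhole (ℕₚ.n<1+n (suc N)) (λ i → orbit (toℕ i))
  ... | i , j , i<j , same with ℕₚ.m≤n⇒∃[o]m+o≡n i<j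
  ...   | o , i+1+o≡j = orbit (toℕ i) , subst (TransClosure A (orbit (toℕ i))) back (orbit-walk o (toℕ i))
    where
    back : orbit (suc (o + toℕ i)) ≡ orbit (toℕ i)
    back = trans (cong orbit (trans (cong suc (ℕₚ.+-comm o (toℕ i))) i+1+o≡j)) (sym same)

sink : ∀ {N} {A : Fin (suc N) → Fin (suc N) → Set} → (∀ u v → Dec (A u v)) → NoCycle A →
       ∃ λ s → ∀ v → ¬ A s v
sink {N} {A} A? acyclic with any? (λ s → all? (λ v → ¬? (A? s v)))
... | yes found = found
... | no none = ⊥-elim (uncurry acyclic (successor-cycle (proj₁ ∘ out) (proj₂ ∘ out)))
  where
  out : ∀ s → ∃ (A s)
  out s with any? (A? s)
  ... | yes o = o
  ... | no ¬o = ⊥-elim (none (s , λ v a → ¬o (v , a)))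

inject₁-mono : ∀ {N} {i j : Fin N} → i Fin.< j → inject₁ i Fin.< inject₁ j
inject₁-mono {i = i} {j} = subst₂ ℕ._<_ (sym (Finₚ.toℕ-inject₁ i)) (sym (Finₚ.toℕ-inject₁ j))

inject₁<fromℕ : ∀ {N} (i : Fin N) → inject₁ i Fin.< fromℕ N
inject₁<fromℕ {N} i = subst (toℕ (inject₁ i) ℕ.<_) (sym (Finₚ.toℕ-fromℕ N)) (Finₚ.inject₁ℕ< i)

-- Topological ranking: an acyclic decidable relation on Fin N embeds into the
-- strict order of Fin N.  A sink gets the top rank; the rest is ranked recursively.
rank : ∀ N {A : Fin N → Fin N → Set} → (∀ u v → Dec (A u v)) → NoCycle A →
       ∃ λ (r : Fin N → Fin N) → ∀ u v → A u v → r u Fin.< r v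
rank zero    A? acyclic = (λ ()) , λ ()
rank (suc N) {A} A? acyclic = r , λ u v → place-mono (s ≟ u) (s ≟ v)
  where
  s : Fin (suc N)
  s = proj₁ (sink A? acyclic)

  rest : ∃ λ (r′ : Fin N → Fin N) → ∀ u v → A (punchIn s u) (punchIn s v) → r′ u Fin.< r′ v
  rest = rank N (λ u v → A? (punchIn s u) (punchIn s v))
                (λ x c → acyclic (punchIn s x) (map⁺ (punchIn s) (λ a → a) c))

  place : ∀ {v} → Dec (s ≡ v) → Fin (suc N)
  place (yes _)   = fromℕ N
  place (no s≢v) = inject₁ (proj₁ rest (punchOut s≢v))

  r : Fin (suc N) → Fin (suc N)
  r v = place (s ≟ v)

  place-mono : ∀ {u v} (du : Dec (s ≡ u)) (dv : Dec (s ≡ v)) → A u v → place du Fin.< place dv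
  place-mono (yes refl) _          a = ⊥-elim (proj₂ (sink A? acyclic) _ a)
  place-mono (no s≢u)   (yes refl) _ = inject₁<fromℕ _
  place-mono (no s≢u)   (no s≢v)   a = inject₁-mono (proj₂ rest _ _
    (subst₂ A (sym (Finₚ.punchIn-punchOut s≢u)) (sym (Finₚ.punchIn-punchOut s≢v)) a))

addIsolated-↑ˡ : ∀ {n} (G : Graph n) k a b → addIsolated G k (a ↑ˡ k) (b ↑ˡ k) ≡ adj G a b
addIsolated-↑ˡ {n} G k a b rewrite Finₚ.splitAt-↑ˡ n a k | Finₚ.splitAt-↑ˡ n b k = refl

addIsolated-old : ∀ {n} (G : Graph n) k x y → T (addIsolated G k x y) →
                  ∃₂ λ a b → a ↑ˡ k ≡ x × b ↑ˡ k ≡ y × Adj G a b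
addIsolated-old {n} G k x y xy with splitAt n x in ex | splitAt n y in ey
... | inj₁ a | inj₁ b = a , b , Finₚ.splitAt⁻¹-↑ˡ ex , Finₚ.splitAt⁻¹-↑ˡ ey , xy
... | inj₁ _ | inj₂ _ = ⊥-elim xy
... | inj₂ _ | _      = ⊥-elim xy

adj-sym : ∀ {n} (G : Graph n) {x y} → Adj G x y → Adj G y x
adj-sym G {x} {y} = subst T (Graph.sym G x y)

adj-≢ : ∀ {n} (G : Graph n) {x y} → Adj G x y → x ≢ y
adj-≢ G {x} xy refl = subst T (irrefl G x) xy

module DiamondFreeCliques {n} (G : Graph n) (diamond-free : DiamondFree G) where

  CommonNbr : Fin n → Fin n → Fin n → Set
  CommonNbr x y z = z ≡ x ⊎ z ≡ y ⊎ (Adj G x z × Adj G y z)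

  commonNbr? : ∀ x y → Decidable (CommonNbr x y)
  commonNbr? x y z = (z ≟ x) ⊎-dec (z ≟ y) ⊎-dec (T? (adj G x z) ×-dec T? (adj G y z))

  M : Fin n → Fin n → Subset n
  M x y = subsetOf (commonNbr? x y)

  x∈M : ∀ {x y} → x ∈ M x y
  x∈M {x} {y} = ∈-subsetOf⁺ (commonNbr? x y) (inj₁ refl)

  y∈M : ∀ {x y} → y ∈ M x y
  y∈M {x} {y} = ∈-subsetOf⁺ (commonNbr? x y) (inj₂ (inj₁ refl))

  -- For an edge xy, M x y is a clique: two common neighbours of x and y are
  -- adjacent, as otherwise they would span a diamond with x and y.
  M-clique : ∀ {x y} → Adj G x y → IsClique G (M x y)
  M-clique {x} {y} xy u v u∈ v∈ u≢v =
    adjacent (∈-subsetOf⁻ (commonNbr? x y) u∈) (∈-subsetOf⁻ (commonNbr? x y) v∈)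
    where
    adjacent : CommonNbr x y u → CommonNbr x y v → Adj G u v
    adjacent (inj₁ refl)               (inj₁ refl)               = contradiction refl u≢v
    adjacent (inj₁ refl)               (inj₂ (inj₁ refl))        = xy
    adjacent (inj₁ refl)               (inj₂ (inj₂ (xv , _)))    = xv
    adjacent (inj₂ (inj₁ refl))        (inj₁ refl)               = adj-sym G xy
    adjacent (inj₂ (inj₁ refl))        (inj₂ (inj₁ refl))        = contradiction refl u≢v
    adjacent (inj₂ (inj₁ refl))        (inj₂ (inj₂ (_ , yv)))    = yv
    adjacent (inj₂ (inj₂ (xu , _)))    (inj₁ refl)               = adj-sym G xu
    adjacent (inj₂ (inj₂ (_ , yu)))    (inj₂ (inj₁ refl))        = adj-sym G yu
    adjacent (inj₂ (inj₂ (xu , yu)))   (inj₂ (inj₂ (xv , yv)))   = diamond-free x y u v xy xu xv yu yv u≢v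

  clique⊆M : ∀ {x y} K → IsClique G K → x ∈ K → y ∈ K → K ⊆ M x y
  clique⊆M {x} {y} K K-clique x∈K y∈K {z} z∈K with z ≟ x | z ≟ y
  ... | yes z≡x | _       = ∈-subsetOf⁺ (commonNbr? x y) (inj₁ z≡x)
  ... | no _    | yes z≡y = ∈-subsetOf⁺ (commonNbr? x y) (inj₂ (inj₁ z≡y))
  ... | no z≢x  | no z≢y  = ∈-subsetOf⁺ (commonNbr? x y)
    (inj₂ (inj₂ (K-clique x z x∈K z∈K (z≢x ∘ sym) , K-clique y z y∈K z∈K (z≢y ∘ sym))))

  M-maximal : ∀ {x y} → Adj G x y → IsMaximalClique G (M x y)
  M-maximal xy = M-clique xy , λ K K-clique M⊆K → clique⊆M K K-clique (M⊆K x∈M) (M⊆K y∈M)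

  M-edge : ∀ {x y u v} → Adj G x y → u ∈ M x y → v ∈ M x y → u ≢ v → M u v ≡ M x y
  M-edge {x} {y} {u} {v} xy u∈ v∈ u≢v = ⊆-antisym Muv⊆Mxy Mxy⊆Muv
    where
    Mxy⊆Muv : M x y ⊆ M u v
    Mxy⊆Muv = clique⊆M _ (M-clique xy) u∈ v∈
    Muv⊆Mxy : M u v ⊆ M x y
    Muv⊆Mxy = clique⊆M _ (M-clique (M-clique xy _ _ u∈ v∈ u≢v)) (Mxy⊆Muv x∈M) (Mxy⊆Muv y∈M)

  pairs : List (Fin n × Fin n)
  pairs = cartesianProduct (allFin n) (allFin n)

  edge? : Decidable (uncurry (Adj G))
  edge? (x , y) = T? (adj G x y)

  edges : List (Fin n × Fin n)
  edges = filter edge? pairs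

  cliques : List (Subset n)
  cliques = deduplicate (≡-dec Bool._≟_) (map (uncurry M) edges)

  t : ℕ
  t = length cliques

  C : Fin t → Subset n
  C = List.lookup cliques

  C-generated : ∀ i → ∃₂ λ x y → Adj G x y × C i ≡ M x y
  C-generated i with ∈-map∘filter⁻ (uncurry M) edge? {xs = pairs}
                     (∈-deduplicate⁻ (≡-dec Bool._≟_) _ (∈-lookup {xs = cliques} i))
  ... | (x , y) , _ , C≡M , xy = x , y , xy , C≡M

  C-contains : ∀ {x y} → Adj G x y → ∃ λ i → C i ≡ M x y
  C-contains {x} {y} xy = Any.index M∈ , sym (lookup-index M∈)
    where
    M∈ : M x y ∈ˡ cliques
    M∈ = ∈-deduplicate⁺ (≡-dec Bool._≟_) (∈-map∘filter⁺ (uncurry M) edge?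
           ((x , y) , ∈-cartesianProduct⁺ (∈-allFin x) (∈-allFin y) , refl , xy))

  C-injective : ∀ i j → C i ≡ C j → i ≡ j
  C-injective = lookup-injective cliques (deduplicate-! (≡-dec Bool._≟_) _)

  C-maximal : ∀ i → IsMaximalClique G (C i)
  C-maximal i with C-generated i
  ... | x , y , xy , C≡M = subst (IsMaximalClique G) (sym C≡M) (M-maximal xy)

  C-clique : ∀ i → IsClique G (C i)
  C-clique = proj₁ ∘ C-maximal

  C-nonempty : ∀ i → ∃ λ x → x ∈ C i
  C-nonempty i with C-generated i
  ... | x , y , xy , C≡M = x , subst (x ∈_) (sym C≡M) x∈M

  C-cover : IsEdgeCliqueCover G t C
  C-cover = C-clique , covers
    where
    covers : ∀ x y → Adj G x y → ∃ λ i → x ∈ C i × y ∈ C i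
    covers x y xy with C-contains xy
    ... | i , C≡M = i , subst (x ∈_) (sym C≡M) x∈M , subst (y ∈_) (sym C≡M) y∈M

  end₁ end₂ : Fin t → Fin n
  end₁ i = proj₁ (C-generated i)
  end₂ i = proj₁ (proj₂ (C-generated i))

  ends-adjacent : ∀ i → Adj G (end₁ i) (end₂ i)
  ends-adjacent i = proj₁ (proj₂ (proj₂ (C-generated i)))

  C≡M-ends : ∀ i → C i ≡ M (end₁ i) (end₂ i)
  C≡M-ends i = proj₂ (proj₂ (proj₂ (C-generated i)))

  C-edge : ∀ i {x y} → x ∈ C i → y ∈ C i → x ≢ y → M x y ≡ C i
  C-edge i {x} {y} x∈ y∈ x≢y =
    trans (M-edge (ends-adjacent i) (subst (x ∈_) (C≡M-ends i) x∈) (subst (y ∈_) (C≡M-ends i) y∈) x≢y)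
          (sym (C≡M-ends i))

  other-member : ∀ i x → ∃ λ e → e ∈ C i × x ≢ e
  other-member i x with x ≟ end₁ i
  ... | yes refl = end₂ i , subst (end₂ i ∈_) (sym (C≡M-ends i)) y∈M , adj-≢ G (ends-adjacent i)
  ... | no x≢e   = end₁ i , subst (end₁ i ∈_) (sym (C≡M-ends i)) x∈M , x≢e

  -- Any edge clique cover needs t cliques: choosing for each C i a covering
  -- clique of its generating edge is injective, because that clique lies
  -- inside C i and so cannot also contain the generating edge of another C j.
  C-minimum : IsMinimumEdgeCliqueCover G t C
  C-minimum = C-cover , λ t′ C′ (cliques′ , covers) → Finₚ.injective⇒≤ (choice-injective C′ cliques′ covers)
    where
    module _ {t′} (C′ : Fin t′ → Subset n) (cliques′ : ∀ c → IsClique G (C′ c))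
             (covers : ∀ x y → Adj G x y → ∃ λ c → x ∈ C′ c × y ∈ C′ c) where

      choice : Fin t → Fin t′
      choice i = proj₁ (covers (end₁ i) (end₂ i) (ends-adjacent i))

      ends∈choice : ∀ i → end₁ i ∈ C′ (choice i) × end₂ i ∈ C′ (choice i)
      ends∈choice i = proj₂ (covers (end₁ i) (end₂ i) (ends-adjacent i))

      choice⊆C : ∀ i → C′ (choice i) ⊆ C i
      choice⊆C i = subst (C′ (choice i) ⊆_) (sym (C≡M-ends i))
        (clique⊆M _ (cliques′ _) (proj₁ (ends∈choice i)) (proj₂ (ends∈choice i)))

      choice-injective : ∀ {i j} → choice i ≡ choice j → i ≡ j
      choice-injective {i} {j} same = C-injective i j (begin
        C i                   ≡⟨ sym (C-edge i (choice⊆C i end₁∈) (choice⊆C i end₂∈) (adj-≢ G (ends-adjacent j))) ⟩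
        M (end₁ j) (end₂ j)   ≡⟨ sym (C≡M-ends j) ⟩
        C j                   ∎)
        where
        open ≡-Reasoning
        end₁∈ : end₁ j ∈ C′ (choice i)
        end₁∈ = subst (λ c → end₁ j ∈ C′ c) (sym same) (proj₁ (ends∈choice j))
        end₂∈ : end₂ j ∈ C′ (choice i)
        end₂∈ = subst (λ c → end₂ j ∈ C′ c) (sym same) (proj₂ (ends∈choice j))

  IsRanked : ∀ k → (Fin t → Fin (n + k)) → (Fin (n + k) → Fin (n + k)) → Set
  IsRanked k w r = (∀ i j → w i ≡ w j → i ≡ j) × (∀ i x → x ∈ C i → r (x ↑ˡ k) Fin.< r (w i))

  RankedLabelling : ℕ → Set
  RankedLabelling k = ∃₂ λ w r → IsRanked k w r

  isRanked? : ∀ k w r → Dec (IsRanked k w r)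
  isRanked? k w r = all? (λ i → all? (λ j → (w i ≟ w j) →-dec (i ≟ j)))
              ×-dec all? (λ i → all? (λ x → (x ∈? C i) →-dec (r (x ↑ˡ k) Finₚ.<? r (w i))))

  rankedLabelling? : ∀ k → Dec (RankedLabelling k)
  rankedLabelling? k =
    ∃-function? t (n + k) resp-w (λ w → ∃-function? (n + k) (n + k) (resp-r w) (isRanked? k w))
    where
    resp-r : ∀ w {r r′} → (∀ v → r v ≡ r′ v) → IsRanked k w r → IsRanked k w r′
    resp-r w r≗r′ (w-injective , ranked) =
      w-injective , λ i x x∈ → subst₂ Fin._<_ (r≗r′ _) (r≗r′ _) (ranked i x x∈)
    resp-w : ∀ {w w′} → (∀ i → w i ≡ w′ i) → ∃ (IsRanked k w) → ∃ (IsRanked k w′)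
    resp-w {w} {w′} w≗w′ (r , w-injective , ranked) =
      r , (λ i j e → w-injective i j (trans (w≗w′ i) (trans e (sym (w≗w′ j))))) ,
      λ i x x∈ → subst (λ v → r (x ↑ˡ k) Fin.< r v) (w≗w′ i) (ranked i x x∈)

  new-vertex-labelling : RankedLabelling t
  new-vertex-labelling = (n ↑ʳ_) , (λ v → v) , (λ i j → Finₚ.↑ʳ-injective n i j) , old<new
    where
    old<new : ∀ i x → x ∈ C i → x ↑ˡ t Fin.< n ↑ʳ i
    old<new i x _ rewrite Finₚ.toℕ-↑ˡ x t | Finₚ.toℕ-↑ʳ n i =
      ℕₚ.<-≤-trans (Finₚ.toℕ<n x) (ℕₚ.m≤m+n n (toℕ i))

  CliqueSinkRealization : ℕ → Set
  CliqueSinkRealization k =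
    Σ (Digraph (n + k)) λ D → Acyclic D × IsCompetitionGraphOf G k D ×
    Σ (Fin t → Fin (n + k)) λ w →
      (∀ v → (∃ λ u → Arc D u v) → ∃ λ i → w i ≡ v) ×
      (∀ v → (∃ λ i → w i ≡ v) → ∃ λ u → Arc D u v) ×
      (∀ i x → x ∈ C i → Arc D (x ↑ˡ k) (w i))

  module FromLabelling {k} (w : Fin t → Fin (n + k)) (r : Fin (n + k) → Fin (n + k))
                       (w-injective : ∀ i j → w i ≡ w j → i ≡ j)
                       (ranked : ∀ i x → x ∈ C i → r (x ↑ˡ k) Fin.< r (w i)) where

    ArcTo : Fin (n + k) → Fin (n + k) → Set
    ArcTo u v = ∃ λ i → w i ≡ v × ∃ λ x → x ↑ˡ k ≡ u × x ∈ C i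

    arcTo? : ∀ u v → Dec (ArcTo u v)
    arcTo? u v = any? λ i → (w i ≟ v) ×-dec any? (λ x → (x ↑ˡ k ≟ u) ×-dec (x ∈? C i))

    arc-rank : ∀ {u v} → ArcTo u v → r u Fin.< r v
    arc-rank (i , refl , x , refl , x∈) = ranked i x x∈

    D : Digraph (n + k)
    D = record
      { arc      = λ u v → ⌊ arcTo? u v ⌋
      ; loopless = λ u → Equivalence.to T-not-≡ (fromWitnessFalse (λ a → Finₚ.<-irrefl refl (arc-rank a)))
      }

    arc⁻ : ∀ {u v} → Arc D u v → ArcTo u v
    arc⁻ = toWitness

    member-arc : ∀ i x → x ∈ C i → Arc D (x ↑ˡ k) (w i)
    member-arc i x x∈ = fromWitness (i , refl , x , refl , x∈)

    path-rank : ∀ {u v} → TransClosure (Arc D) u v → r u Fin.< r v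
    path-rank [ a ]   = arc-rank (arc⁻ a)
    path-rank (a ∷ p) = Finₚ.<-trans (arc-rank (arc⁻ a)) (path-rank p)

    D-acyclic : Acyclic D
    D-acyclic x cycle = Finₚ.<-irrefl refl (path-rank cycle)

    -- Two old vertices have a common out-neighbour iff they lie in a common
    -- clique C i (w is injective), i.e. iff they are adjacent.
    D-competition : IsCompetitionGraphOf G k D
    D-competition x y x≢y = edge⇒prey , prey⇒edge
      where
      edge⇒prey : T (addIsolated G k x y) → ∃ λ z → Arc D x z × Arc D y z
      edge⇒prey xy with addIsolated-old G k x y xy
      ... | a , b , refl , refl , ab with C-contains ab
      ... | i , C≡M = w i , member-arc i a (subst (a ∈_) (sym C≡M) x∈M)
                          , member-arc i b (subst (b ∈_) (sym C≡M) y∈M)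
      prey⇒edge : (∃ λ z → Arc D x z × Arc D y z) → T (addIsolated G k x y)
      prey⇒edge (z , xz , yz) with arc⁻ xz | arc⁻ yz
      ... | i , refl , a , refl , a∈ | j , wj≡wi , b , refl , b∈ with w-injective j i wj≡wi
      ... | refl = subst T (sym (addIsolated-↑ˡ G k a b))
                         (C-clique i a b a∈ b∈ (x≢y ∘ cong (_↑ˡ k)))

    realization : CliqueSinkRealization k
    realization = D , D-acyclic , D-competition , w , in-arc⇒label , label⇒in-arc , member-arc
      where
      in-arc⇒label : ∀ v → (∃ λ u → Arc D u v) → ∃ λ i → w i ≡ v
      in-arc⇒label v (u , a) with arc⁻ a
      ... | i , wi≡v , _ = i , wi≡v
      label⇒in-arc : ∀ v → (∃ λ i → w i ≡ v) → ∃ λ u → Arc D u v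
      label⇒in-arc v (i , refl) with C-nonempty i
      ... | x , x∈ = x ↑ˡ k , member-arc i x x∈

  module ToLabelling {k} (D : Digraph (n + k)) (D-acyclic : Acyclic D)
                     (D-competition : IsCompetitionGraphOf G k D) where

    ↑ˡ-≢ : ∀ {a b : Fin n} → a ≢ b → a ↑ˡ k ≢ b ↑ˡ k
    ↑ˡ-≢ a≢b = a≢b ∘ Finₚ.↑ˡ-injective k _ _

    adj⇒prey : ∀ {a b} → Adj G a b → ∃ λ z → Arc D (a ↑ˡ k) z × Arc D (b ↑ˡ k) z
    adj⇒prey {a} {b} ab =
      proj₁ (D-competition _ _ (↑ˡ-≢ (adj-≢ G ab))) (subst T (sym (addIsolated-↑ˡ G k a b)) ab)

    prey : Fin (n + k) → Subset n
    prey z = subsetOf (λ a → T? (arc D (a ↑ˡ k) z))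

    prey-clique : ∀ z → IsClique G (prey z)
    prey-clique z a b a∈ b∈ a≢b = subst T (addIsolated-↑ˡ G k a b)
      (proj₂ (D-competition _ _ (↑ˡ-≢ a≢b)) (z , ∈-subsetOf⁻ _ a∈ , ∈-subsetOf⁻ _ b∈))

    Witness : Fin t → Fin (n + k) → Set
    Witness i z = ∃₂ λ a b → Adj G a b × Arc D (a ↑ˡ k) z × Arc D (b ↑ˡ k) z × M a b ≡ C i

    witness? : ∀ i → Decidable (Witness i)
    witness? i z = any? λ a → any? λ b →
      T? (adj G a b) ×-dec T? (arc D (a ↑ˡ k) z) ×-dec T? (arc D (b ↑ˡ k) z) ×-dec ≡-dec Bool._≟_ (M a b) (C i)

    -- A vertex witnesses at most one clique: its prey form a clique, which by
    -- diamond-freeness lies in the single clique M a b of any edge ab it preys on.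
    witness-unique : ∀ {i j z} → Witness i z → Witness j z → i ≡ j
    witness-unique {i} {j} {z} (a , b , ab , az , bz , Mab≡Ci) (c , d , cd , cz , dz , Mcd≡Cj) =
      C-injective i j (begin
        C i    ≡⟨ sym Mab≡Ci ⟩
        M a b  ≡⟨ M-edge cd (prey⊆Mcd (∈-subsetOf⁺ _ az)) (prey⊆Mcd (∈-subsetOf⁺ _ bz)) (adj-≢ G ab) ⟩
        M c d  ≡⟨ Mcd≡Cj ⟩
        C j    ∎)
      where
      open ≡-Reasoning
      prey⊆Mcd : prey z ⊆ M c d
      prey⊆Mcd = clique⊆M (prey z) (prey-clique z) (∈-subsetOf⁺ _ cz) (∈-subsetOf⁺ _ dz)

    member-witness : ∀ i x → x ∈ C i → ∃ λ z → Witness i z × Arc D (x ↑ˡ k) z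
    member-witness i x x∈ with other-member i x
    ... | e , e∈ , x≢e with adj⇒prey (C-clique i x e x∈ e∈ x≢e)
    ...   | z , xz , ez = z , (x , e , C-clique i x e x∈ e∈ x≢e , xz , ez , C-edge i x∈ e∈ x≢e) , xz

    some-witness : ∀ i → ∃ (Witness i)
    some-witness i =
      let x , x∈ = C-nonempty i
          z , z-witness , _ = member-witness i x x∈
      in z , z-witness

    ranking : ∃ λ (r : Fin (n + k) → Fin (n + k)) → ∀ u v → Arc D u v → r u Fin.< r v
    ranking = rank (n + k) (λ u v → T? (arc D u v)) D-acyclic

    r : Fin (n + k) → Fin (n + k)
    r = proj₁ ranking

    latest-witness : ∀ i → ∃ λ z → Witness i z × (∀ y → Witness i y → toℕ (r y) ℕ.≤ toℕ (r z))
    latest-witness i =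
      maximise (witness? i) (toℕ ∘ r) (some-witness i)

    w : Fin t → Fin (n + k)
    w i = proj₁ (latest-witness i)

    labelling : RankedLabelling k
    labelling = w , r , w-injective , ranked
      where
      w-injective : ∀ i j → w i ≡ w j → i ≡ j
      w-injective i j wi≡wj =
        witness-unique (subst (Witness i) wi≡wj (proj₁ (proj₂ (latest-witness i)))) (proj₁ (proj₂ (latest-witness j)))
      ranked : ∀ i x → x ∈ C i → r (x ↑ˡ k) Fin.< r (w i)
      ranked i x x∈ =
        let z , z-witness , xz = member-witness i x x∈
        in ℕₚ.<-≤-trans (proj₂ ranking _ _ xz) (proj₂ (proj₂ (latest-witness i)) z z-witness)

-- The least k admitting a ranked labelling is the competition number, and the
-- realization built from such a labelling shows that the canonical cover is
-- an effective competition cover.  (The construction does not need G to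
-- have an edge.)
corollary2p5 : ∀ (n : ℕ) (G : Graph n) → DiamondFree G → HasEdge G →
    Σ ℕ λ t → Σ (Fin t → Subset n) λ C → IsEffectiveCompetitionCover G t C
corollary2p5 n G diamond-free _ =
  t , C , C-minimum , C-maximal , k , (realizable , k-least) , realization
  where
  open DiamondFreeCliques G diamond-free

  smallest : ∃ λ k → RankedLabelling k × (∀ j → RankedLabelling j → k ℕ.≤ j)
  smallest = least rankedLabelling? t new-vertex-labelling

  k : ℕ
  k = proj₁ smallest

  realization : CliqueSinkRealization k
  realization =
    let w , r , w-injective , ranked = proj₁ (proj₂ smallest)
    in FromLabelling.realization w r w-injective ranked

  realizable : Realizable G k
  realizable = let D , D-acyclic , D-competition , _ = realization in D , D-acyclic , D-competition

  k-least : ∀ k′ → Realizable G k′ → k ℕ.≤ k′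
  k-least k′ (D , D-acyclic , D-competition) =
    proj₂ (proj₂ smallest) k′ (ToLabelling.labelling D D-acyclic D-competition)
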